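{- Let $H$ be a graph that contains the double triangle graph as a minor. Then for every graph $G$, the complement of the $2$-subdivision of $G$ is an $H$-graph; that is, $\overline{\mathrm{SUBD}_2} \subseteq H\text{ -graphs}$, where $\overline{\mathrm{SUBD}_2}$ denotes the class of complements of $2$-subdivisions of graphs.
   Context: All graphs are finite and simple. The double triangle graph is the multigraph on three vertices $x_1,x_2,x_3$ in which each pair $x_i,x_j$ ($i\neq j$) is joined by exactly two parallel edges. Saying $H$ contains it as a minor means the vertex set of $H$ can be partitioned into three sets inducing connected subgraphs $H_1,H_2,H_3$ such that for each $i\neq j$ there are at least two edges of $H$ with one end in $H_i$ and the other in $H_j$. The $2$-subdivision of a graph $G$ is obtained by replacing every edge $uv$ of $G$ by a path $u,a,b,v$ with two new internal vertices. The complement of a graph $G$ is denoted $\overline{G}$. For a fixed graph $H$, a graph $G$ is an $H$-graph if there is a subdivision $H'$ of $H$ and a family $\{H'_v : v\in V(G)\}$ of connected subgraphs of $H'$ such that for all distinct $u,v\in V(G)$, $uv\in E(G)$ if and only if $H'_u$ and $H'_v$ share at least one vertex. -}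

module Defs where

open import Data.Nat using (ℕ; zero; suc)
open import Data.Fin using (Fin; zero; suc; _≟_; _<_)
open import Data.Bool using (Bool; true; false; _∧_; _∨_; not)
open import Data.Product using (Σ; Σ-syntax; ∃; ∃-syntax; _×_; _,_; proj₁; proj₂)
open import Data.Sum using (_⊎_; inj₁; inj₂)
open import Data.Empty using (⊥)
open import Relation.Nullary using (¬_)
open import Relation.Nullary.Decidable using (⌊_⌋)
open import Relation.Binary.PropositionalEquality using (_≡_; _≢_)
open import Function.Bundles using (_⇔_)

record Graph : Set where
  field
    n   : ℕ
    adj : Fin n → Fin n → Bool
open Graph public

IsSimple : Graph → Set
IsSimple G = (∀ x → adj G x x ≡ false) × (∀ x y → adj G x y ≡ adj G y x)

-- Walks in G whose vertices all lie in S (endpoints' membership stated separately).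
data WalkIn (G : Graph) (S : Fin (n G) → Set) : Fin (n G) → Fin (n G) → Set where
  here : ∀ {x} → WalkIn G S x x
  step : ∀ {x y z} → S y → adj G x y ≡ true → WalkIn G S y z → WalkIn G S x z

ConnectedSub : (G : Graph) → (Fin (n G) → Set) → Set
ConnectedSub G S = (∃[ x ] S x) × (∀ x y → S x → S y → WalkIn G S x y)

-- Double triangle minor: partition f : V(H) → {1,2,3}, each part connected,
-- and between any two distinct parts at least two (distinct) edges.
TwoEdgesBetween : (H : Graph) → (Fin (n H) → Fin 3) → Fin 3 → Fin 3 → Set
TwoEdgesBetween H f i j =
  Σ[ a ∈ Fin (n H) ] Σ[ b ∈ Fin (n H) ] Σ[ c ∈ Fin (n H) ] Σ[ d ∈ Fin (n H) ]
    (f a ≡ i) × (f b ≡ j) × (f c ≡ i) × (f d ≡ j)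
    × (adj H a b ≡ true) × (adj H c d ≡ true) × ¬ ((a ≡ c) × (b ≡ d))

HasDoubleTriangleMinor : Graph → Set
HasDoubleTriangleMinor H =
  Σ[ f ∈ (Fin (n H) → Fin 3) ]
    (∀ i → ConnectedSub H (λ x → f x ≡ i))
    × (∀ i j → i ≢ j → TwoEdgesBetween H f i j)

-- Elementary subdivision of the edge uv: new vertex zero, old vertex x ↦ suc x;
-- the edge uv is removed and edges u–new, new–v are added.
subdivideEdge : (G : Graph) → Fin (n G) → Fin (n G) → Graph
subdivideEdge G u v = record { n = suc (n G) ; adj = a }
  where
  isUV : Fin (n G) → Bool
  isUV y = ⌊ y ≟ u ⌋ ∨ ⌊ y ≟ v ⌋
  a : Fin (suc (n G)) → Fin (suc (n G)) → Bool
  a zero    zero    = false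
  a zero    (suc y) = isUV y
  a (suc x) zero    = isUV x
  a (suc x) (suc y) = adj G x y ∧ not ((⌊ x ≟ u ⌋ ∧ ⌊ y ≟ v ⌋) ∨ (⌊ x ≟ v ⌋ ∧ ⌊ y ≟ u ⌋))

data IsSubdivisionOf (H : Graph) : Graph → Set where
  base : IsSubdivisionOf H H
  sub  : ∀ {H'} → IsSubdivisionOf H H' → (u v : Fin (n H')) → adj H' u v ≡ true
       → IsSubdivisionOf H (subdivideEdge H' u v)

IsHGraph : Graph → (V : Set) → (V → V → Set) → Set₁
IsHGraph H V E =
  Σ[ H' ∈ Graph ] IsSubdivisionOf H H' ×
    Σ[ M ∈ (V → Fin (n H') → Set) ]
      (∀ v → ConnectedSub H' (M v))
      × (∀ u v → u ≢ v → (E u v ⇔ (∃[ x ] (M u x × M v x))))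

EdgeOf : Graph → Set
EdgeOf G = Σ[ p ∈ Fin (n G) × Fin (n G) ] (proj₁ p < proj₂ p) × (adj G (proj₁ p) (proj₂ p) ≡ true)

-- Vertices of the 2-subdivision: original vertices, and for each edge uv
-- two new vertices (e , false) (next to u) and (e , true) (next to v).
Subd2Vertex : Graph → Set
Subd2Vertex G = Fin (n G) ⊎ (EdgeOf G × Bool)

Subd2Adj : (G : Graph) → Subd2Vertex G → Subd2Vertex G → Set
Subd2Adj G (inj₁ x) (inj₁ y) = ⊥
Subd2Adj G (inj₁ x) (inj₂ (e , false)) = x ≡ proj₁ (proj₁ e)
Subd2Adj G (inj₁ x) (inj₂ (e , true))  = x ≡ proj₂ (proj₁ e)
Subd2Adj G (inj₂ (e , false)) (inj₁ x) = x ≡ proj₁ (proj₁ e)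
Subd2Adj G (inj₂ (e , true))  (inj₁ x) = x ≡ proj₂ (proj₁ e)
Subd2Adj G (inj₂ (e , b)) (inj₂ (e' , b')) = (proj₁ e ≡ proj₁ e') × (b ≢ b')

CoSubd2Adj : (G : Graph) → Subd2Vertex G → Subd2Vertex G → Set
CoSubd2Adj G x y = (x ≢ y) × ¬ Subd2Adj G x y

module Submission where

-- Let f split H into connected branch sets 0, 1, 2 with two edges ("links") between
-- any two of them, and subdivide each of the six links into a path with positions
-- 0, …, L.  A model (a connected subgraph of the subdivided H) consists of one whole
-- branch set, its hub, together with segments of the link paths attached to the hub.
-- On the two paths of a pair of branch sets, an upper segment coding a and a lower
-- segment coding b meet iff a ≠ b: one path detects a < b, the other b < a.
-- Vertices of G get hub 2, the subdivision vertices near the first (second) end of an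
-- edge get hub 0 (hub 1), and the segments compare a vertex of G with an edge end, or
-- the codes of two edges; so two models meet iff the vertices are nonadjacent in the
-- 2-subdivision.

open import Defs
open import Data.Nat using (ℕ; zero; suc; _+_; _*_; _∸_; _≤_; _<_; z≤n; s≤s)
import Data.Nat.Properties as ℕₚ
open import Data.Fin using (Fin; zero; suc; toℕ; _≟_; combine)
open import Data.Fin.Properties using (suc-injective; toℕ-injective; toℕ<n; combine-injective)
open import Data.Bool using (Bool; true; false; _∧_; _∨_; not)
open import Data.Bool.Properties using (∧-comm; ∨-comm; ∨-zeroʳ)
open import Data.Product using (Σ-syntax; ∃-syntax; _×_; _,_; proj₁; proj₂)
open import Data.Sum using (_⊎_; inj₁; inj₂)
open import Data.Empty using (⊥; ⊥-elim)
open import Data.Unit using (⊤; tt)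
open import Relation.Nullary using (¬_; yes; no)
open import Relation.Nullary.Decidable using (⌊_⌋; isYes≗does; dec-true)
open import Relation.Binary.PropositionalEquality
open import Function using (_∘_)
open import Data.Fin.Patterns using (0F; 1F; 2F; 3F; 4F; 5F)
open import Function.Bundles using (_⇔_; mk⇔; Equivalence)
open import Function.Construct.Composition using (_⇔-∘_)
open import Relation.Binary.Definitions using (tri<; tri≈; tri>)

Undirected : Graph → Set
Undirected G = ∀ x y → adj G x y ≡ adj G y x

SameEdge : ∀ {m} → Fin m → Fin m → Fin m × Fin m → Set
SameEdge x y (u , v) = (x ≡ u × y ≡ v) ⊎ (x ≡ v × y ≡ u)

first-not-endpoint : ∀ {m} {x y u v : Fin m} → x ≢ u → x ≢ v → ¬ SameEdge x y (u , v)
first-not-endpoint x≢u _ (inj₁ (x≡u , _)) = x≢u x≡u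
first-not-endpoint _ x≢v (inj₂ (x≡v , _)) = x≢v x≡v

second-not-endpoint : ∀ {m} {x y u v : Fin m} → y ≢ u → y ≢ v → ¬ SameEdge x y (u , v)
second-not-endpoint _ y≢v (inj₁ (_ , y≡v)) = y≢v y≡v
second-not-endpoint y≢u _ (inj₂ (_ , y≡u)) = y≢u y≡u

neither-is-first : ∀ {m} {x y u v : Fin m} → x ≢ u → y ≢ u → ¬ SameEdge x y (u , v)
neither-is-first x≢u _ (inj₁ (x≡u , _)) = x≢u x≡u
neither-is-first _ y≢u (inj₂ (_ , y≡u)) = y≢u y≡u

neither-is-second : ∀ {m} {x y u v : Fin m} → x ≢ v → y ≢ v → ¬ SameEdge x y (u , v)
neither-is-second _ y≢v (inj₁ (_ , y≡v)) = y≢v y≡v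
neither-is-second x≢v _ (inj₂ (x≡v , _)) = x≢v x≡v

SameEdge-reflect : ∀ {m k} (φ : Fin m → Fin k) → (∀ {a b} → φ a ≡ φ b → a ≡ b) →
  ∀ {x y u v} → SameEdge (φ x) (φ y) (φ u , φ v) → SameEdge x y (u , v)
SameEdge-reflect φ inj (inj₁ (p , q)) = inj₁ (inj p , inj q)
SameEdge-reflect φ inj (inj₂ (p , q)) = inj₂ (inj p , inj q)

module _ {G : Graph} {S : Fin (n G) → Set} where

  _++ᵂ_ : ∀ {x y z} → WalkIn G S x y → WalkIn G S y z → WalkIn G S x z
  here ++ᵂ w = w
  step s e w ++ᵂ w' = step s e (w ++ᵂ w')

  -- In an undirected graph a walk can be traversed backwards; its start,
  -- which a walk does not record, must then lie in S.
  reverseᵂ : Undirected G → ∀ {x y} → S x → WalkIn G S x y → WalkIn G S y x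
  reverseᵂ sym sx here = here
  reverseᵂ sym {x} sx (step {y = y} sy e w) =
    reverseᵂ sym sy w ++ᵂ step sx (trans (sym y x) e) here

mapᵂ : ∀ {G G' S S'} (φ : Fin (n G) → Fin (n G')) →
  (∀ {x} → S x → S' (φ x)) →
  (∀ {x y} → S x → S y → adj G x y ≡ true → adj G' (φ x) (φ y) ≡ true) →
  ∀ {x y} → S x → WalkIn G S x y → WalkIn G' S' (φ x) (φ y)
mapᵂ φ keepS keepE sx here = here
mapᵂ φ keepS keepE sx (step sy e w) = step (keepS sy) (keepE sx sy e) (mapᵂ φ keepS keepE sy w)

subdivision-trans : ∀ {H K K'} → IsSubdivisionOf H K → IsSubdivisionOf K K' → IsSubdivisionOf H K'
subdivision-trans p base = p
subdivision-trans p (sub q u v e) = sub (subdivision-trans p q) u v e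

module ElementarySubdivision (G : Graph) (u v : Fin (n G)) where
  private
    S = subdivideEdge G u v

  test-equal : ∀ {x y : Fin (n G)} → x ≡ y → ⌊ x ≟ y ⌋ ≡ true
  test-equal {x} {y} x≡y = trans (isYes≗does (x ≟ y)) (dec-true (x ≟ y) x≡y)

  new-u : adj S (suc u) zero ≡ true
  new-u = cong (_∨ ⌊ u ≟ v ⌋) (test-equal refl)

  new-v : adj S zero (suc v) ≡ true
  new-v = trans (cong (⌊ v ≟ u ⌋ ∨_) (test-equal refl)) (∨-zeroʳ _)

  pair-test : ∀ {x y a b : Fin (n G)} → ¬ (x ≡ a × y ≡ b) → (⌊ x ≟ a ⌋ ∧ ⌊ y ≟ b ⌋) ≡ false
  pair-test {x} {y} {a} {b} ne with x ≟ a | y ≟ b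
  ... | yes p | yes q = ⊥-elim (ne (p , q))
  ... | yes _ | no _  = refl
  ... | no _  | _     = refl

  old-edge : ∀ x y → adj G x y ≡ true → ¬ SameEdge x y (u , v) → adj S (suc x) (suc y) ≡ true
  old-edge x y e ne
    rewrite e | pair-test (λ p → ne (inj₁ p)) | pair-test (λ p → ne (inj₂ p)) = refl

  undirected : Undirected G → Undirected S
  undirected sym zero    zero    = refl
  undirected sym zero    (suc y) = refl
  undirected sym (suc x) zero    = refl
  undirected sym (suc x) (suc y) =
    cong₂ (λ a b → a ∧ not b) (sym x y)
      (trans (cong₂ _∨_ (∧-comm ⌊ x ≟ u ⌋ _) (∧-comm ⌊ x ≟ v ⌋ _))
             (∨-comm (⌊ y ≟ v ⌋ ∧ ⌊ x ≟ u ⌋) _))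

subdivision-undirected : ∀ {H H'} → Undirected H → IsSubdivisionOf H H' → Undirected H'
subdivision-undirected sym base = sym
subdivision-undirected sym (sub p u v _) =
  ElementarySubdivision.undirected _ u v (subdivision-undirected sym p)

record PathSubdivision (K : Graph) {r : ℕ} (ends : Fin r → Fin (n K) × Fin (n K)) (L : ℕ) : Set where
  field
    K'         : Graph
    subdiv     : IsSubdivisionOf K K'
    ι          : Fin (n K) → Fin (n K')
    ι-inj      : ∀ {x y} → ι x ≡ ι y → x ≡ y
    path       : Fin r → ℕ → Fin (n K')
    path-inj   : ∀ {j j' i i'} → i ≤ L → i' ≤ L → path j i ≡ path j' i' → j ≡ j' × i ≡ i'
    ι≢path     : ∀ x j {i} → i ≤ L → ι x ≢ path j i
    old-edge   : ∀ x y → adj K x y ≡ true → (∀ j → ¬ SameEdge x y (ends j)) →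
                 adj K' (ι x) (ι y) ≡ true
    path-start : ∀ j → adj K' (ι (proj₁ (ends j))) (path j 0) ≡ true
    path-step  : ∀ j {i} → i < L → adj K' (path j i) (path j (suc i)) ≡ true
    path-end   : ∀ j → adj K' (path j L) (ι (proj₂ (ends j))) ≡ true

record ProperEdges (K : Graph) {r : ℕ} (ends : Fin r → Fin (n K) × Fin (n K)) : Set where
  field
    is-edge  : ∀ j → adj K (proj₁ (ends j)) (proj₂ (ends j)) ≡ true
    non-loop : ∀ j → proj₁ (ends j) ≢ proj₂ (ends j)
    distinct : ∀ {j j'} → j ≢ j' → ¬ SameEdge (proj₁ (ends j)) (proj₂ (ends j)) (ends j')

-- A single edge ab is turned into a path of L + 1 new vertices by subdividing L + 1
-- times, each time the edge between a and the newest vertex.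
subdivide-edge : (K : Graph) (a b : Fin (n K)) → a ≢ b → adj K a b ≡ true →
  (L : ℕ) → PathSubdivision K {1} (λ _ → a , b) L
subdivide-edge K a b a≢b ab zero = record
  { K'         = subdivideEdge K a b
  ; subdiv     = sub base a b ab
  ; ι          = suc
  ; ι-inj      = suc-injective
  ; path       = λ _ _ → zero
  ; path-inj   = λ { {zero} {zero} z≤n z≤n _ → refl , refl }
  ; ι≢path     = λ _ _ _ ()
  ; old-edge   = λ x y e avoid → E.old-edge x y e (avoid zero)
  ; path-start = λ _ → E.new-u
  ; path-step  = λ _ ()
  ; path-end   = λ _ → E.new-v
  }
  where module E = ElementarySubdivision K a b
subdivide-edge K a b a≢b ab (suc L) = record
  { K'         = subdivideEdge R.K' (R.ι a) (p 0)
  ; subdiv     = sub R.subdiv (R.ι a) (p 0) (R.path-start zero)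
  ; ι          = λ x → suc (R.ι x)
  ; ι-inj      = λ e → R.ι-inj (suc-injective e)
  ; path       = path
  ; path-inj   = path-inj
  ; ι≢path     = ι≢path
  ; old-edge   = λ x y e avoid → E.old-edge (R.ι x) (R.ι y) (R.old-edge x y e avoid)
                   (neither-is-second (R.ι≢path x zero z≤n) (R.ι≢path y zero z≤n))
  ; path-start = λ _ → E.new-u
  ; path-step  = path-step
  ; path-end   = λ _ → E.old-edge (p L) (R.ι b) (R.path-end zero)
                   (neither-is-first (p≢ιa ℕₚ.≤-refl) (a≢b ∘ sym ∘ R.ι-inj))
  }
  where
  R = subdivide-edge K a b a≢b ab L
  module R = PathSubdivision R
  module E = ElementarySubdivision R.K' (R.ι a) (R.path zero 0)
  p : ℕ → Fin (n R.K')
  p = R.path zero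

  p≢ιa : ∀ {i} → i ≤ L → p i ≢ R.ι a
  p≢ιa i≤L e = R.ι≢path a zero i≤L (sym e)

  path : Fin 1 → ℕ → Fin (n (subdivideEdge R.K' (R.ι a) (p 0)))
  path _ zero    = zero
  path _ (suc i) = suc (p i)

  path-inj : ∀ {j j' i i'} → i ≤ suc L → i' ≤ suc L → path j i ≡ path j' i' → j ≡ j' × i ≡ i'
  path-inj {zero} {zero} {zero}  {zero}  _       _        _ = refl , refl
  path-inj {zero} {zero} {suc i} {suc i'} (s≤s h) (s≤s h') e =
    refl , cong suc (proj₂ (R.path-inj h h' (suc-injective e)))

  ι≢path : ∀ x j {i} → i ≤ suc L → suc (R.ι x) ≢ path j i
  ι≢path x j {suc i} (s≤s h) e = R.ι≢path x zero h (suc-injective e)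

  path-step : ∀ j {i} → i < suc L →
    adj (subdivideEdge R.K' (R.ι a) (p 0)) (path j i) (path j (suc i)) ≡ true
  path-step _ {zero}  _       = E.new-v
  path-step _ {suc i} (s≤s h) = E.old-edge (p i) (p (suc i)) (R.path-step zero h)
    (neither-is-first (p≢ιa (ℕₚ.<⇒≤ h)) (p≢ιa h))

subdivide-first-then-rest : ∀ {K r L} {ends : Fin (suc r) → Fin (n K) × Fin (n K)} →
  (P : PathSubdivision K {1} (λ _ → ends zero) L) →
  let module P = PathSubdivision P in
  PathSubdivision P.K' (λ j → P.ι (proj₁ (ends (suc j))) , P.ι (proj₂ (ends (suc j)))) L →
  PathSubdivision K ends L
subdivide-first-then-rest {K} {r} {L} {ends} P Q = record
  { K'         = Q.K'
  ; subdiv     = subdivision-trans P.subdiv Q.subdiv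
  ; ι          = ι
  ; ι-inj      = λ e → P.ι-inj (Q.ι-inj e)
  ; path       = path
  ; path-inj   = path-inj
  ; ι≢path     = ι≢path
  ; old-edge   = λ x y e avoid → Q.old-edge (P.ι x) (P.ι y) (P.old-edge x y e (λ _ → avoid zero))
                   (λ j same → avoid (suc j) (SameEdge-reflect P.ι P.ι-inj same))
  ; path-start = λ { zero    → Q.old-edge _ _ (P.path-start zero)
                                 (λ _ → second-not-endpoint (off z≤n) (off z≤n))
                   ; (suc j) → Q.path-start j }
  ; path-step  = λ { zero h    → Q.old-edge _ _ (P.path-step zero h)
                                   (λ _ → first-not-endpoint (off (ℕₚ.<⇒≤ h)) (off (ℕₚ.<⇒≤ h)))
                   ; (suc j) h → Q.path-step j h }
  ; path-end   = λ { zero    → Q.old-edge _ _ (P.path-end zero)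
                                 (λ _ → first-not-endpoint (off ℕₚ.≤-refl) (off ℕₚ.≤-refl))
                   ; (suc j) → Q.path-end j }
  }
  where
  module P = PathSubdivision P
  module Q = PathSubdivision Q

  ι : Fin (n K) → Fin (n Q.K')
  ι x = Q.ι (P.ι x)

  path : Fin (suc r) → ℕ → Fin (n Q.K')
  path zero    i = Q.ι (P.path zero i)
  path (suc j) i = Q.path j i

  -- The first path avoids the old vertices, hence all endpoints of the other edges.
  off : ∀ {i x} → i ≤ L → P.path zero i ≢ P.ι x
  off {x = x} h e = P.ι≢path x zero h (sym e)

  path-inj : ∀ {j j' i i'} → i ≤ L → i' ≤ L → path j i ≡ path j' i' → j ≡ j' × i ≡ i'
  path-inj {zero}  {zero}   h h' e = refl , proj₂ (P.path-inj h h' (Q.ι-inj e))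
  path-inj {zero}  {suc j'} h h' e = ⊥-elim (Q.ι≢path _ j' h' e)
  path-inj {suc j} {zero}   h h' e = ⊥-elim (Q.ι≢path _ j h (sym e))
  path-inj {suc j} {suc j'} h h' e with Q.path-inj h h' e
  ... | refl , i≡i' = refl , i≡i'

  ι≢path : ∀ x j {i} → i ≤ L → ι x ≢ path j i
  ι≢path x zero    h e = P.ι≢path x zero h (Q.ι-inj e)
  ι≢path x (suc j) h e = Q.ι≢path (P.ι x) j h e

subdivide-edges : (K : Graph) {r : ℕ} (ends : Fin r → Fin (n K) × Fin (n K)) →
  ProperEdges K ends → (L : ℕ) → PathSubdivision K ends L
subdivide-edges K {zero} ends _ L = record
  { K' = K ; subdiv = base ; ι = λ x → x ; ι-inj = λ e → e ; path = λ ()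
  ; path-inj = λ { {()} } ; ι≢path = λ _ () ; old-edge = λ x y e _ → e
  ; path-start = λ () ; path-step = λ () ; path-end = λ () }
subdivide-edges K {suc r} ends proper L =
  subdivide-first-then-rest P (subdivide-edges P.K' rest proper-rest L)
  where
  open ProperEdges proper
  P = subdivide-edge K _ _ (non-loop zero) (is-edge zero) L
  module P = PathSubdivision P

  rest : Fin r → Fin (n P.K') × Fin (n P.K')
  rest j = P.ι (proj₁ (ends (suc j))) , P.ι (proj₂ (ends (suc j)))

  proper-rest : ProperEdges P.K' rest
  proper-rest = record
    { is-edge  = λ j → P.old-edge _ _ (is-edge (suc j)) (λ _ → distinct λ ())
    ; non-loop = λ j e → non-loop (suc j) (P.ι-inj e)
    ; distinct = λ j≢j' same →
        distinct (λ e → j≢j' (suc-injective e)) (SameEdge-reflect P.ι P.ι-inj same)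
    }

-- Comparing two numbers a, b ≤ L with a pair of paths with positions 0, …, L:
-- a claims an upper segment and b a lower segment of each path, the two
-- segments meeting on the first path iff a < b and on the second iff b < a.
module Comparator (L : ℕ) where

  Upper : ℕ → Bool → ℕ → Set
  Upper a false i = a < i
  Upper a true  i = L ≤ i + a

  Lower : ℕ → Bool → ℕ → Set
  Lower b false i = i ≤ b
  Lower b true  i = i + b < L

  upper-closed : ∀ {a} σ {i j} → i ≤ j → Upper a σ i → Upper a σ j
  upper-closed false i≤j a<i  = ℕₚ.<-≤-trans a<i i≤j
  upper-closed true  i≤j L≤ia = ℕₚ.≤-trans L≤ia (ℕₚ.+-monoˡ-≤ _ i≤j)

  lower-closed : ∀ {b} σ {i j} → j ≤ i → Lower b σ i → Lower b σ j
  lower-closed false j≤i i≤b  = ℕₚ.≤-trans j≤i i≤b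
  lower-closed true  j≤i ib<L = ℕₚ.≤-<-trans (ℕₚ.+-monoˡ-≤ _ j≤i) ib<L

  Meet : ℕ → ℕ → Set
  Meet a b = ∃[ σ ] ∃[ i ] i ≤ L × Upper a σ i × Lower b σ i

  comparator : ∀ {a b} → a ≤ L → b ≤ L → a ≢ b ⇔ Meet a b
  comparator {a} {b} a≤L b≤L = mk⇔ to from
    where
    to : a ≢ b → Meet a b
    to a≢b with ℕₚ.<-cmp a b
    ... | tri< a<b _ _ = false , b , b≤L , a<b , ℕₚ.≤-refl
    ... | tri≈ _ a≡b _ = ⊥-elim (a≢b a≡b)
    ... | tri> _ _ b<a = true , L ∸ a , ℕₚ.m∸n≤m L a
                       , ℕₚ.≤-reflexive (sym (ℕₚ.m∸n+n≡m a≤L))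
                       , subst (L ∸ a + b <_) (ℕₚ.m∸n+n≡m a≤L) (ℕₚ.+-monoʳ-< (L ∸ a) b<a)

    from : Meet a b → a ≢ b
    from (false , i , _ , a<i , i≤b)  refl = ℕₚ.<-irrefl refl (ℕₚ.<-≤-trans a<i i≤b)
    from (true  , i , _ , L≤ia , ia<L) refl = ℕₚ.<-irrefl refl (ℕₚ.≤-<-trans L≤ia ia<L)

  coded : ∀ {A : Set} (code : A → ℕ) → (∀ {x y} → code x ≡ code y → x ≡ y) → (∀ x → code x ≤ L) →
    ∀ x y → x ≢ y ⇔ Meet (code x) (code y)
  coded code code-inj bound x y =
    comparator (bound x) (bound y) ⇔-∘ mk⇔ (λ x≢y → x≢y ∘ code-inj) (λ ne → ne ∘ cong code)

module _ {H : Graph} {f : Fin (n H) → Fin 3} {i j : Fin 3} where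

  twoEdges : TwoEdgesBetween H f i j → Bool → Fin (n H) × Fin (n H)
  twoEdges (a , b , _)         false = a , b
  twoEdges (_ , _ , c , d , _) true  = c , d

  twoEdges-from : (t : TwoEdgesBetween H f i j) → ∀ σ → f (proj₁ (twoEdges t σ)) ≡ i
  twoEdges-from (_ , _ , _ , _ , fa , _ , _ , _ , _) false = fa
  twoEdges-from (_ , _ , _ , _ , _ , _ , fc , _ , _) true  = fc

  twoEdges-to : (t : TwoEdgesBetween H f i j) → ∀ σ → f (proj₂ (twoEdges t σ)) ≡ j
  twoEdges-to (_ , _ , _ , _ , _ , fb , _ , _ , _) false = fb
  twoEdges-to (_ , _ , _ , _ , _ , _ , _ , fd , _) true  = fd

  twoEdges-adj : (t : TwoEdgesBetween H f i j) → ∀ σ →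
    adj H (proj₁ (twoEdges t σ)) (proj₂ (twoEdges t σ)) ≡ true
  twoEdges-adj (_ , _ , _ , _ , _ , _ , _ , _ , ab , _ , _) false = ab
  twoEdges-adj (_ , _ , _ , _ , _ , _ , _ , _ , _ , cd , _) true  = cd

  twoEdges-injective : (t : TwoEdgesBetween H f i j) → ∀ {σ σ'} →
    proj₁ (twoEdges t σ) ≡ proj₁ (twoEdges t σ') → proj₂ (twoEdges t σ) ≡ proj₂ (twoEdges t σ') → σ ≡ σ'
  twoEdges-injective t {false} {false} _ _ = refl
  twoEdges-injective (_ , _ , _ , _ , _ , _ , _ , _ , _ , _ , ab≢cd) {false} {true} p q =
    ⊥-elim (ab≢cd (p , q))
  twoEdges-injective (_ , _ , _ , _ , _ , _ , _ , _ , _ , _ , ab≢cd) {true} {false} p q =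
    ⊥-elim (ab≢cd (sym p , sym q))
  twoEdges-injective t {true}  {true}  _ _ = refl

-- The branch sets of the double triangle minor are 0F, 1F, 2F.  The pair π consists
-- of the two branch sets other than π, ordered as lo π < hi π.
lo hi : Fin 3 → Fin 3
lo 0F = 1F
lo 1F = 0F
lo 2F = 0F
hi 0F = 2F
hi 1F = 2F
hi 2F = 1F

lo<hi : ∀ π → toℕ (lo π) < toℕ (hi π)
lo<hi 0F = s≤s (s≤s z≤n)
lo<hi 1F = s≤s z≤n
lo<hi 2F = s≤s z≤n

lo≢hi : ∀ π → lo π ≢ hi π
lo≢hi π e = ℕₚ.<-irrefl (cong toℕ e) (lo<hi π)

pair-determined : ∀ {π π'} → lo π ≡ lo π' → hi π ≡ hi π' → π ≡ π'
pair-determined {0F} {0F} _ _ = refl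
pair-determined {1F} {1F} _ _ = refl
pair-determined {2F} {2F} _ _ = refl
pair-determined {0F} {1F} () _
pair-determined {0F} {2F} () _
pair-determined {1F} {0F} () _
pair-determined {1F} {2F} _ ()
pair-determined {2F} {0F} () _
pair-determined {2F} {1F} _ ()

pair-not-reversed : ∀ {π π'} → lo π ≡ hi π' → hi π ≡ lo π' → ⊥
pair-not-reversed {π} {π'} lo≡hi hi≡lo =
  ℕₚ.<-asym (subst₂ _<_ (cong toℕ lo≡hi) (cong toℕ hi≡lo) (lo<hi π)) (lo<hi π')

linkOf : Fin 6 → Fin 3 × Bool
linkOf 0F = 0F , false
linkOf 1F = 0F , true
linkOf 2F = 1F , false
linkOf 3F = 1F , true
linkOf 4F = 2F , false
linkOf 5F = 2F , true

indexOf : Fin 3 × Bool → Fin 6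
indexOf (0F , false) = 0F
indexOf (0F , true)  = 1F
indexOf (1F , false) = 2F
indexOf (1F , true)  = 3F
indexOf (2F , false) = 4F
indexOf (2F , true)  = 5F

linkOf-indexOf : ∀ l → linkOf (indexOf l) ≡ l
linkOf-indexOf (0F , false) = refl
linkOf-indexOf (0F , true)  = refl
linkOf-indexOf (1F , false) = refl
linkOf-indexOf (1F , true)  = refl
linkOf-indexOf (2F , false) = refl
linkOf-indexOf (2F , true)  = refl

linkOf-injective : ∀ {k k'} → linkOf k ≡ linkOf k' → k ≡ k'
linkOf-injective {k} {k'} e = trans (sym (indexOf-linkOf k)) (trans (cong indexOf e) (indexOf-linkOf k'))
  where
  indexOf-linkOf : ∀ k → indexOf (linkOf k) ≡ k
  indexOf-linkOf 0F = refl
  indexOf-linkOf 1F = refl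
  indexOf-linkOf 2F = refl
  indexOf-linkOf 3F = refl
  indexOf-linkOf 4F = refl
  indexOf-linkOf 5F = refl

-- The six edges of H linking the branch sets of a double triangle minor f: two for
-- each pair.  They are pairwise different, so they can all be subdivided into paths.
module Linking (H : Graph) (f : Fin (n H) → Fin 3)
               (two : ∀ i j → i ≢ j → TwoEdgesBetween H f i j) where

  link : Fin 3 × Bool → Fin (n H) × Fin (n H)
  link (π , σ) = twoEdges (two (lo π) (hi π) (lo≢hi π)) σ

  link-from : ∀ l → f (proj₁ (link l)) ≡ lo (proj₁ l)
  link-from (π , σ) = twoEdges-from (two (lo π) (hi π) (lo≢hi π)) σ

  link-to : ∀ l → f (proj₂ (link l)) ≡ hi (proj₁ l)
  link-to (π , σ) = twoEdges-to (two (lo π) (hi π) (lo≢hi π)) σ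

  link-adj : ∀ l → adj H (proj₁ (link l)) (proj₂ (link l)) ≡ true
  link-adj (π , σ) = twoEdges-adj (two (lo π) (hi π) (lo≢hi π)) σ

  same-branch : ∀ {x y c c'} → f x ≡ c → x ≡ y → f y ≡ c' → c ≡ c'
  same-branch fx≡c refl fy≡c' = trans (sym fx≡c) fy≡c'

  links-differ : ∀ {l l'} → SameEdge (proj₁ (link l)) (proj₂ (link l)) (link l') → l ≡ l'
  links-differ {π , σ} {π' , σ'} (inj₁ (p , q))
    with pair-determined (same-branch (link-from (π , σ)) p (link-from (π' , σ')))
                         (same-branch (link-to (π , σ)) q (link-to (π' , σ')))
  ... | refl = cong (π ,_) (twoEdges-injective (two (lo π) (hi π) (lo≢hi π)) p q)
  links-differ {l} {l'} (inj₂ (p , q)) = ⊥-elim (pair-not-reversed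
    (same-branch (link-from l) p (link-to l')) (same-branch (link-to l) q (link-from l')))

  inside-not-link : ∀ {x y} l → f x ≡ f y → ¬ SameEdge x y (link l)
  inside-not-link l fx≡fy (inj₁ (refl , refl)) =
    lo≢hi _ (same-branch (link-from l) refl (trans fx≡fy (link-to l)))
  inside-not-link l fx≡fy (inj₂ (refl , refl)) =
    lo≢hi _ (same-branch (link-from l) refl (trans (sym fx≡fy) (link-to l)))

  ends : Fin 6 → Fin (n H) × Fin (n H)
  ends k = link (linkOf k)

  proper : ProperEdges H ends
  proper = record
    { is-edge  = λ k → link-adj (linkOf k)
    ; non-loop = λ k e → inside-not-link (linkOf k) (cong f e) (inj₁ (refl , refl))
    ; distinct = λ k≢k' same → k≢k' (linkOf-injective (links-differ same))
    }

-- A model is described by a shape: a branch set (its hub) and a role on each pair.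
module Models (H : Graph) (H-undirected : Undirected H) (f : Fin (n H) → Fin 3)
              (conn : ∀ c → ConnectedSub H (λ x → f x ≡ c))
              (two : ∀ i j → i ≢ j → TwoEdgesBetween H f i j) (L : ℕ)
              (subdivision : PathSubdivision H (Linking.ends H f two) L) where

  open Linking H f two
  open Comparator L

  open PathSubdivision subdivision public using (K'; subdiv)
  open PathSubdivision subdivision using (ι; ι-inj; path; path-inj; ι≢path; old-edge;
                                          path-start; path-step; path-end)

  K'-undirected : Undirected K'
  K'-undirected = subdivision-undirected H-undirected subdiv

  backwards : ∀ {x y} → adj K' x y ≡ true → adj K' y x ≡ true
  backwards {x} {y} e = trans (K'-undirected y x) e

  src tgt : Fin 6 → Fin (n H)
  src k = proj₁ (ends k)
  tgt k = proj₂ (ends k)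

  pair : Fin 6 → Fin 3
  pair k = proj₁ (linkOf k)

  side : Fin 6 → Bool
  side k = proj₂ (linkOf k)

  data Site : Set where
    old : Fin (n H) → Site
    at  : Fin 6 → ℕ → Site

  Valid : Site → Set
  Valid (old _)  = ⊤
  Valid (at _ i) = i ≤ L

  embed : Site → Fin (n K')
  embed (old x)  = ι x
  embed (at k i) = path k i

  embed-inj : ∀ {s s'} → Valid s → Valid s' → embed s ≡ embed s' → s ≡ s'
  embed-inj {old x}  {old y}   _ _  e = cong old (ι-inj e)
  embed-inj {old x}  {at k i}  _ h  e = ⊥-elim (ι≢path x k h e)
  embed-inj {at k i} {old x}   h _  e = ⊥-elim (ι≢path x k h (sym e))
  embed-inj {at k i} {at k' i'} h h' e with path-inj h h' e
  ... | refl , refl = refl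

  -- On the two paths of a pair, a model claims nothing, an upper segment
  -- (attached to the hi end) or a lower segment (attached to the lo end).
  data Role : Set where
    absent      : Role
    upper lower : ℕ → Role

  Occupies : Role → Bool → ℕ → Set
  Occupies absent    _ _ = ⊥
  Occupies (upper a) σ i = Upper a σ i
  Occupies (lower b) σ i = Lower b σ i

  Anchored : Fin 3 → Fin 3 → Role → Set
  Anchored c π absent    = ⊤
  Anchored c π (upper _) = c ≡ hi π
  Anchored c π (lower _) = c ≡ lo π

  record Shape : Set where
    field
      hub      : Fin 3
      role     : Fin 3 → Role
      anchored : ∀ π → Anchored hub π (role π)
  open Shape public

  InShape : Shape → Site → Set
  InShape S (old x)  = f x ≡ hub S
  InShape S (at k i) = Occupies (role S (pair k)) (side k) i

  Model : Shape → Fin (n K') → Set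
  Model S x = Σ[ s ∈ Site ] Valid s × InShape S s × embed s ≡ x

  root : Shape → Fin (n H)
  root S = proj₁ (proj₁ (conn (hub S)))

  root-in : ∀ S → f (root S) ≡ hub S
  root-in S = proj₂ (proj₁ (conn (hub S)))

  -- The hub's branch set is connected inside the model: its edges are not links.
  within-branch : ∀ S {x y} → f x ≡ hub S → f y ≡ hub S → WalkIn K' (Model S) (ι x) (ι y)
  within-branch S fx fy = mapᵂ ι (λ {y} fy → old y , tt , fy , refl)
    (λ fx fy e → old-edge _ _ e (λ k → inside-not-link (linkOf k) (trans fx (sym fy))))
    fx (proj₂ (conn (hub S)) _ _ fx fy)

  data Reach (c : Fin 3) (k : Fin 6) (ρ : Role) : Set where
    from-start : f (src k) ≡ c →
                 (∀ {i j} → j ≤ i → Occupies ρ (side k) i → Occupies ρ (side k) j) → Reach c k ρ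
    from-end   : f (tgt k) ≡ c →
                 (∀ {i j} → i ≤ j → Occupies ρ (side k) i → Occupies ρ (side k) j) → Reach c k ρ
    unclaimed  : (∀ {i} → ¬ Occupies ρ (side k) i) → Reach c k ρ

  reach : ∀ {c} k ρ → Anchored c (pair k) ρ → Reach c k ρ
  reach k absent    _     = unclaimed λ ()
  reach k (upper a) c≡hi  = from-end (trans (link-to (linkOf k)) (sym c≡hi)) (upper-closed (side k))
  reach k (lower b) c≡lo  = from-start (trans (link-from (linkOf k)) (sym c≡lo)) (lower-closed (side k))

  descend : ∀ S k → f (src k) ≡ hub S →
    (∀ {i j} → j ≤ i → InShape S (at k i) → InShape S (at k j)) →
    ∀ {i} → i ≤ L → InShape S (at k i) → WalkIn K' (Model S) (path k i) (ι (src k))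
  descend S k start closed {zero}  _   _       =
    step (old (src k) , tt , start , refl) (backwards (path-start k)) here
  descend S k start closed {suc i} i<L claimed =
    step (at k i , ℕₚ.<⇒≤ i<L , claimed' , refl) (backwards (path-step k i<L))
         (descend S k start closed (ℕₚ.<⇒≤ i<L) claimed')
    where claimed' = closed (ℕₚ.n≤1+n i) claimed

  ascend : ∀ S k → f (tgt k) ≡ hub S →
    (∀ {i j} → i ≤ j → InShape S (at k i) → InShape S (at k j)) →
    ∀ d {i} → d + i ≡ L → InShape S (at k i) → WalkIn K' (Model S) (path k i) (ι (tgt k))
  ascend S k end closed zero    refl _       =
    step (old (tgt k) , tt , end , refl) (path-end k) here
  ascend S k end closed (suc d) {i} d+i≡L claimed =
    step (at k (suc i) , i<L , claimed' , refl) (path-step k i<L)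
         (ascend S k end closed d (trans (ℕₚ.+-suc d i) d+i≡L) claimed')
    where
    claimed' = closed (ℕₚ.n≤1+n i) claimed
    i<L : i < L
    i<L = subst (i <_) d+i≡L (s≤s (ℕₚ.m≤n+m i d))

  to-root : ∀ S {x} → Model S x → WalkIn K' (Model S) x (ι (root S))
  to-root S (old x , _ , fx , refl) = within-branch S fx (root-in S)
  to-root S (at k i , i≤L , claimed , refl) with reach k (role S (pair k)) (anchored S (pair k))
  ... | from-start start closed =
    descend S k start closed i≤L claimed ++ᵂ within-branch S start (root-in S)
  ... | from-end end closed =
    ascend S k end closed (L ∸ i) (ℕₚ.m∸n+n≡m i≤L) claimed ++ᵂ within-branch S end (root-in S)
  ... | unclaimed none = ⊥-elim (none claimed)

  model-connected : ∀ S → ConnectedSub K' (Model S)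
  model-connected S = (ι (root S) , old (root S) , tt , root-in S , refl)
    , λ x y x∈S y∈S → to-root S x∈S ++ᵂ reverseᵂ K'-undirected y∈S (to-root S y∈S)

  Shares : Role → Role → Set
  Shares ρ ρ' = ∃[ σ ] ∃[ i ] i ≤ L × Occupies ρ σ i × Occupies ρ' σ i

  Overlap : Shape → Shape → Set
  Overlap S S' = hub S ≡ hub S' ⊎ ∃[ π ] Shares (role S π) (role S' π)

  overlap-sym : ∀ {S S'} → Overlap S S' → Overlap S' S
  overlap-sym (inj₁ same-hub)                    = inj₁ (sym same-hub)
  overlap-sym (inj₂ (π , σ , i , i≤L , o , o')) = inj₂ (π , σ , i , i≤L , o' , o)

  models-meet : ∀ S S' → Overlap S S' ⇔ (∃[ x ] Model S x × Model S' x)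
  models-meet S S' = mk⇔ to from
    where
    to : Overlap S S' → ∃[ x ] Model S x × Model S' x
    to (inj₁ same-hub) = ι (root S) , (old (root S) , tt , root-in S , refl)
                                    , (old (root S) , tt , trans (root-in S) same-hub , refl)
    to (inj₂ (π , σ , i , i≤L , o , o')) =
      path k i , (at k i , i≤L , claim S o , refl) , (at k i , i≤L , claim S' o' , refl)
      where
      k = indexOf (π , σ)
      claim : ∀ T → Occupies (role T π) σ i → InShape T (at k i)
      claim T = subst (λ l → Occupies (role T (proj₁ l)) (proj₂ l) i)
                      (sym (linkOf-indexOf (π , σ)))

    from : ∃[ x ] Model S x × Model S' x → Overlap S S'
    from (_ , (s , v , in-S , refl) , (s' , v' , in-S' , e)) with embed-inj v' v e
    from (_ , (old x , _ , in-S , refl) , (_ , _ , in-S' , _)) | refl =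
      inj₁ (trans (sym in-S) in-S')
    from (_ , (at k i , v , in-S , refl) , (_ , _ , in-S' , _)) | refl =
      inj₂ (pair k , side k , i , v , in-S , in-S')

subd2-sym : ∀ {G} X Y → Subd2Adj G X Y → Subd2Adj G Y X
subd2-sym (inj₁ x)           (inj₂ (e , false)) x≡u = x≡u
subd2-sym (inj₁ x)           (inj₂ (e , true))  x≡v = x≡v
subd2-sym (inj₂ (e , false)) (inj₁ x)           x≡u = x≡u
subd2-sym (inj₂ (e , true))  (inj₁ x)           x≡v = x≡v
subd2-sym (inj₂ (e , false)) (inj₂ (e' , false)) (e≡e' , b≢b') = sym e≡e' , b≢b' ∘ sym
subd2-sym (inj₂ (e , false)) (inj₂ (e' , true))  (e≡e' , b≢b') = sym e≡e' , b≢b' ∘ sym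
subd2-sym (inj₂ (e , true))  (inj₂ (e' , false)) (e≡e' , b≢b') = sym e≡e' , b≢b' ∘ sym
subd2-sym (inj₂ (e , true))  (inj₂ (e' , true))  (e≡e' , b≢b') = sym e≡e' , b≢b' ∘ sym

complement : ∀ {G X Y} → X ≢ Y → CoSubd2Adj G X Y ⇔ (¬ Subd2Adj G X Y)
complement X≢Y = mk⇔ proj₂ (X≢Y ,_)

-- Vertices w of G are coded by toℕ w < N, pairs (u , v) by
-- toℕ (combine u v) < N * N, and the paths have positions 0, …, N * N + N.
module Representation (H : Graph) (H-undirected : Undirected H) (f : Fin (n H) → Fin 3)
                      (conn : ∀ c → ConnectedSub H (λ x → f x ≡ c))
                      (two : ∀ i j → i ≢ j → TwoEdgesBetween H f i j) (G : Graph)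
                      (subdivision : PathSubdivision H (Linking.ends H f two) (n G * n G + n G))
                      where

  N L : ℕ
  N = n G
  L = N * N + N

  open Models H H-undirected f conn two L subdivision public
  open Comparator L

  pairCode : Fin N × Fin N → ℕ
  pairCode (u , v) = toℕ (combine u v)

  vertices-compared : ∀ w u → w ≢ u ⇔ Meet (toℕ w) (toℕ u)
  vertices-compared = coded toℕ toℕ-injective
    (λ w → ℕₚ.≤-trans (ℕₚ.<⇒≤ (toℕ<n w)) (ℕₚ.m≤n+m N (N * N)))

  pairs-compared : ∀ e e' → e ≢ e' ⇔ Meet (pairCode e) (pairCode e')
  pairs-compared = coded pairCode pairCode-inj
    (λ (u , v) → ℕₚ.≤-trans (ℕₚ.<⇒≤ (toℕ<n (combine u v))) (ℕₚ.m≤m+n (N * N) N))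
    where
    pairCode-inj : ∀ {e e'} → pairCode e ≡ pairCode e' → e ≡ e'
    pairCode-inj {u , v} {u' , v'} c≡c' with combine-injective u v u' v' (toℕ-injective c≡c')
    ... | refl , refl = refl

  vertexShape : Fin N → Shape
  vertexShape w = record
    { hub = 2F
    ; role = λ { 0F → upper (toℕ w) ; 1F → upper (toℕ w) ; 2F → absent }
    ; anchored = λ { 0F → refl ; 1F → refl ; 2F → tt } }

  nearFirstShape : Fin N × Fin N → Shape
  nearFirstShape (u , v) = record
    { hub = 0F
    ; role = λ { 0F → absent ; 1F → lower (toℕ u) ; 2F → lower (pairCode (u , v)) }
    ; anchored = λ { 0F → tt ; 1F → refl ; 2F → refl } }

  nearSecondShape : Fin N × Fin N → Shape
  nearSecondShape (u , v) = record
    { hub = 1F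
    ; role = λ { 0F → lower (toℕ v) ; 1F → absent ; 2F → upper (pairCode (u , v)) }
    ; anchored = λ { 0F → refl ; 1F → tt ; 2F → refl } }

  shape : Subd2Vertex G → Shape
  shape (inj₁ w)           = vertexShape w
  shape (inj₂ (q , false)) = nearFirstShape (proj₁ q)
  shape (inj₂ (q , true))  = nearSecondShape (proj₁ q)

  Represents : Subd2Vertex G → Subd2Vertex G → Set
  Represents X Y = (¬ Subd2Adj G X Y) ⇔ Overlap (shape X) (shape Y)

  mirror : ∀ X Y → Represents X Y → Represents Y X
  mirror X Y rep =
    mk⇔ (λ ¬adj → overlap-sym {shape X} {shape Y} (Equivalence.to rep (¬adj ∘ subd2-sym X Y)))
        (λ meet → Equivalence.from rep (overlap-sym {shape Y} {shape X} meet) ∘ subd2-sym Y X)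

  same-hub : ∀ X Y → hub (shape X) ≡ hub (shape Y) → ¬ Subd2Adj G X Y → Represents X Y
  same-hub _ _ same ¬adj = mk⇔ (λ _ → inj₁ same) (λ _ → ¬adj)

  -- w is adjacent to the vertex of the edge uv next to u iff w = u; pair 1 compares them.
  vertex-vs-near-first : ∀ w q → Represents (inj₁ w) (inj₂ (q , false))
  vertex-vs-near-first w ((u , v) , _) = mk⇔
    (λ w≢u → inj₂ (1F , Equivalence.to (vertices-compared w u) w≢u))
    (λ { (inj₁ ())
       ; (inj₂ (0F , _ , _ , _ , _ , ()))
       ; (inj₂ (1F , meet)) → Equivalence.from (vertices-compared w u) meet
       ; (inj₂ (2F , _ , _ , _ , () , _)) })

  -- w is adjacent to the vertex of the edge uv next to v iff w = v; pair 0 compares them.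
  vertex-vs-near-second : ∀ w q → Represents (inj₁ w) (inj₂ (q , true))
  vertex-vs-near-second w ((u , v) , _) = mk⇔
    (λ w≢v → inj₂ (0F , Equivalence.to (vertices-compared w v) w≢v))
    (λ { (inj₁ ())
       ; (inj₂ (0F , meet)) → Equivalence.from (vertices-compared w v) meet
       ; (inj₂ (1F , _ , _ , _ , _ , ()))
       ; (inj₂ (2F , _ , _ , _ , () , _)) })

  -- The two subdivision vertices near u of e and near v of e' are adjacent iff e = e';
  -- pair 2 compares the codes of e and e'.
  near-first-vs-near-second : ∀ q q' → Represents (inj₂ (q , false)) (inj₂ (q' , true))
  near-first-vs-near-second (e , _) (e' , _) = mk⇔
    (λ ¬adj → inj₂ (2F , to-shares
                 (Equivalence.to (pairs-compared e' e) (λ e'≡e → ¬adj (sym e'≡e , λ ())))))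
    (λ { (inj₁ ())
       ; (inj₂ (0F , _ , _ , _ , () , _))
       ; (inj₂ (1F , _ , _ , _ , _ , ()))
       ; (inj₂ (2F , shared)) (e≡e' , _) →
           Equivalence.from (pairs-compared e' e) (from-shares shared) (sym e≡e') })
    where
    to-shares : Meet (pairCode e') (pairCode e) → Shares (lower (pairCode e)) (upper (pairCode e'))
    to-shares (σ , i , i≤L , up , low) = σ , i , i≤L , low , up

    from-shares : Shares (lower (pairCode e)) (upper (pairCode e')) → Meet (pairCode e') (pairCode e)
    from-shares (σ , i , i≤L , low , up) = σ , i , i≤L , up , low

  represents : ∀ X Y → Represents X Y
  represents X@(inj₁ _) Y@(inj₁ _) = same-hub X Y refl λ ()
  represents (inj₁ w) (inj₂ (q , false)) = vertex-vs-near-first w q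
  represents (inj₁ w) (inj₂ (q , true))  = vertex-vs-near-second w q
  represents X@(inj₂ (q , false)) Y@(inj₁ w) = mirror Y X (vertex-vs-near-first w q)
  represents X@(inj₂ (q , true))  Y@(inj₁ w) = mirror Y X (vertex-vs-near-second w q)
  represents X@(inj₂ (_ , false)) Y@(inj₂ (_ , false)) = same-hub X Y refl λ (_ , f≢f) → f≢f refl
  represents X@(inj₂ (_ , true))  Y@(inj₂ (_ , true))  = same-hub X Y refl λ (_ , t≢t) → t≢t refl
  represents (inj₂ (q , false)) (inj₂ (q' , true)) = near-first-vs-near-second q q'
  represents X@(inj₂ (q , true)) Y@(inj₂ (q' , false)) = mirror Y X (near-first-vs-near-second q' q)

mainTheorem1 : (H : Graph) → IsSimple H → HasDoubleTriangleMinor H →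
    (G : Graph) → IsSimple G → IsHGraph H (Subd2Vertex G) (CoSubd2Adj G)
mainTheorem1 H (_ , H-undirected) (f , conn , two) G _ =
  K' , subdiv , (λ X → Model (shape X)) , (λ X → model-connected (shape X)) ,
  λ X Y X≢Y → models-meet (shape X) (shape Y) ⇔-∘ (represents X Y ⇔-∘ complement X≢Y)
  where
  open Linking H f two using (ends; proper)
  open Representation H H-undirected f conn two G (subdivide-edges H ends proper _)
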